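{- Let $G$ be a graph, $k\ge1$ an integer, and $G'$ a $k$-sparsifier of $G$. If $\mathcal{T}$ is a $k$-lean tree decomposition of $G'$, then $\mathcal{T}$ is also a $k$-lean tree decomposition of $G$.
   Context: Graphs are finite, simple, undirected. A $k$-sparsifier of $G$ is a subgraph $G'$ of $G$ with $V(G')=V(G)$ such that for every $S\subseteq V(G)$ with $|S|<k$, the graphs $G-S$ and $G'-S$ have the same connected components (as vertex sets). A tree decomposition $(T,\mathsf{bag})$ of a graph $H$ requires every edge of $H$ inside some bag and, for each vertex, the nodes whose bags contain it to induce a non-empty connected subtree; the adhesion of $st\in E(T)$ is $\mathsf{bag}(s)\cap\mathsf{bag}(t)$. It is $k$-lean (for $H$) if all adhesions have size $<k$ and for all nodes $t_1,t_2$ and $X_1\subseteq\mathsf{bag}(t_1)$, $X_2\subseteq\mathsf{bag}(t_2)$, if some vertex set of size $k'<\min(|X_1|,|X_2|,k)$ meets every path in $H$ having a vertex in $X_1$ and a vertex in $X_2$, then some edge on the $(t_1,t_2)$-path in $T$ has adhesion of size $\le k'$. -}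

module Defs where

open import Data.Nat using (ℕ; suc; _≤_; _<_)
open import Data.Fin using (Fin)
open import Data.Bool using (Bool; true; false)
open import Data.List using (List; []; _∷_)
open import Data.List.Relation.Unary.Unique.Propositional using (Unique)
open import Data.List.Relation.Unary.Any using (Any)
open import Data.Fin.Subset using (Subset; _∈_; _∉_; _⊆_; _∩_; ∣_∣)
open import Data.Product using (Σ; ∃; _×_; _,_)
open import Relation.Binary.PropositionalEquality using (_≡_)
open import Relation.Nullary using (¬_)

record Graph (n : ℕ) : Set where
  field
    adj   : Fin n → Fin n → Bool
    sym   : ∀ u v → adj u v ≡ adj v u
    irrfl : ∀ v → adj v v ≡ false
open Graph public

_∼[_]_ : ∀ {n} → Fin n → Graph n → Fin n → Set
u ∼[ G ] v = adj G u v ≡ true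

_⊑_ : ∀ {n} → Graph n → Graph n → Set
G' ⊑ G = ∀ u v → u ∼[ G' ] v → u ∼[ G ] v

data Walk {n} (G : Graph n) : Fin n → Fin n → Set where
  [_]  : (x : Fin n) → Walk G x x
  _∷⟨_⟩_ : (x : Fin n) {y z : Fin n} → x ∼[ G ] y → Walk G y z → Walk G x z

verts : ∀ {n} {G : Graph n} {x y} → Walk G x y → List (Fin n)
verts [ x ] = x ∷ []
verts (x ∷⟨ _ ⟩ w) = x ∷ verts w

record Path {n} (G : Graph n) (x y : Fin n) : Set where
  constructor path
  field
    walk     : Walk G x y
    distinct : Unique (verts walk)
open Path public

data EdgeOn {n} {G : Graph n} : ∀ {x y} → Walk G x y → Fin n → Fin n → Set where
  here  : ∀ {x y z} (e : x ∼[ G ] y) (w : Walk G y z) → EdgeOn (x ∷⟨ e ⟩ w) x y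
  there : ∀ {x y z s t} (e : x ∼[ G ] y) {w : Walk G y z} →
          EdgeOn w s t → EdgeOn (x ∷⟨ e ⟩ w) s t

-- Connectivity in the subgraph induced by the vertices satisfying A
data Reach {n} (G : Graph n) (A : Fin n → Set) : Fin n → Fin n → Set where
  rfl  : ∀ {x} → A x → Reach G A x x
  step : ∀ {x y z} → A x → x ∼[ G ] y → Reach G A y z → Reach G A x z

-- G - S and G' - S have the same connected components (as vertex sets):
-- two vertices outside S lie in a common component of G - S iff they do in G' - S.
SameComponentsMinus : ∀ {n} → Graph n → Graph n → Subset n → Set
SameComponentsMinus G G' S =
  ∀ u v → u ∉ S → v ∉ S →
    (Reach G (λ x → x ∉ S) u v → Reach G' (λ x → x ∉ S) u v) ×
    (Reach G' (λ x → x ∉ S) u v → Reach G (λ x → x ∉ S) u v)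

IsSparsifier : ∀ {n} → ℕ → Graph n → Graph n → Set
IsSparsifier {n} k G G' =
  G' ⊑ G × (∀ (S : Subset n) → ∣ S ∣ < k → SameComponentsMinus G G' S)

IsTree : ∀ {m} → Graph m → Set
IsTree {m} T =
  Σ ℕ (λ m' → m ≡ suc m') ×
  (∀ x y → Path T x y) ×
  (∀ x y (p q : Path T x y) → verts (walk p) ≡ verts (walk q))

record IsTreeDecomp {n m} (H : Graph n) (T : Graph m) (bag : Fin m → Subset n) : Set where
  field
    tree      : IsTree T
    edgeCov   : ∀ u v → u ∼[ H ] v → ∃ λ t → u ∈ bag t × v ∈ bag t
    vertNonEm : ∀ v → ∃ λ t → v ∈ bag t
    vertConn  : ∀ v t₁ t₂ → v ∈ bag t₁ → v ∈ bag t₂ →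
                Reach T (λ t → v ∈ bag t) t₁ t₂

adhesion : ∀ {n m} → (Fin m → Subset n) → Fin m → Fin m → Subset n
adhesion bag s t = bag s ∩ bag t

Separates : ∀ {n} → Graph n → Subset n → Subset n → Subset n → Set
Separates H Z X₁ X₂ =
  ∀ x y (p : Path H x y) →
    Any (λ a → a ∈ X₁) (verts (walk p)) →
    Any (λ b → b ∈ X₂) (verts (walk p)) →
    Any (λ c → c ∈ Z) (verts (walk p))

record IsKLean {n m} (k : ℕ) (H : Graph n) (T : Graph m) (bag : Fin m → Subset n) : Set where
  field
    treeDecomp : IsTreeDecomp H T bag
    smallAdh   : ∀ s t → s ∼[ T ] t → ∣ adhesion bag s t ∣ < k
    lean       : ∀ t₁ t₂ (X₁ X₂ : Subset n) → X₁ ⊆ bag t₁ → X₂ ⊆ bag t₂ →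
                 ∀ (k' : ℕ) (Z : Subset n) → ∣ Z ∣ ≡ k' →
                 k' < ∣ X₁ ∣ → k' < ∣ X₂ ∣ → k' < k →
                 Separates H Z X₁ X₂ →
                 ∀ (P : Path T t₁ t₂) →
                 ∃ λ s → ∃ λ t → EdgeOn (walk P) s t × ∣ adhesion bag s t ∣ ≤ k'

-- The lean condition only gets easier to satisfy when edges are added, since
-- separators in G still separate in the subgraph G'. The real content is that every
-- edge uv of G lies in a bag. If it does not, walk along the tree path from a bag of u
-- to a bag of v and stop at the first tree edge st whose far end t no longer contains u;
-- then v is not in bag s either, so u and v avoid the adhesion A of st, which has fewer
-- than k vertices. Being adjacent in G - A, they are connected in G' - A, and pushing
-- that connection through the decomposition of G' yields a tree walk from s to t that
-- never uses the edge st, which is impossible in a tree.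
module Submission where

open import Defs
open import Data.Nat using (ℕ; _≤_)
open import Data.Fin using (Fin; _≟_)
open import Data.Fin.Subset using (Subset; _∈_; _∉_)
open import Data.Fin.Subset.Properties using (_∈?_; x∈p∩q⁺; x∈p∩q⁻)
open import Data.List using ([]; _∷_)
open import Data.List.Relation.Unary.Any using (Any; here; there; any?)
open import Data.List.Relation.Unary.All using (All; []; _∷_)
open import Data.List.Relation.Unary.All.Properties using (¬Any⇒All¬)
open import Data.List.Relation.Unary.Unique.Propositional using (Unique)
open import Data.List.Relation.Unary.AllPairs using ([]; _∷_)
open import Data.Product using (Σ; ∃; _×_; _,_; proj₁; proj₂; map₂)
open import Data.Sum using (_⊎_; inj₁; inj₂)
open import Data.Empty using (⊥; ⊥-elim)
open import Function using (_∘_; id; _$_)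
open import Relation.Unary using (Decidable)
open import Relation.Binary using (Rel)
open import Relation.Binary.Construct.Closure.ReflexiveTransitive
  using (Star; ε; _◅_; _◅◅_; reverse)
open import Relation.Nullary using (¬_; yes; no)
open import Relation.Binary.PropositionalEquality as ≡ using (_≡_; _≢_; refl; subst)

∼-sym : ∀ {n} (G : Graph n) {u v} → u ∼[ G ] v → v ∼[ G ] u
∼-sym G {u} {v} u∼v = ≡.trans (sym G v u) u∼v

∼-irrefl : ∀ {n} (G : Graph n) {u v} → u ∼[ G ] v → u ≢ v
∼-irrefl G {u} u∼u refl with ≡.trans (≡.sym u∼u) (irrfl G u)
... | ()

reach-head : ∀ {n} {G : Graph n} {A : Fin n → Set} {x z} → Reach G A x z → A x
reach-head (rfl Ax)      = Ax
reach-head (step Ax _ _) = Ax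

walk-head : ∀ {n} {G : Graph n} {P : Fin n → Set} {x y}
            (w : Walk G x y) → All P (verts w) → P x
walk-head [ _ ]         (Px ∷ _) = Px
walk-head (_ ∷⟨ _ ⟩ _) (Px ∷ _) = Px

module _ {n} {G G' : Graph n} (G'⊑G : G' ⊑ G) where

  mapWalk : ∀ {x y} → Walk G' x y → Walk G x y
  mapWalk [ x ]         = [ x ]
  mapWalk (x ∷⟨ e ⟩ w) = x ∷⟨ G'⊑G _ _ e ⟩ mapWalk w

  verts-mapWalk : ∀ {x y} (w : Walk G' x y) → verts (mapWalk w) ≡ verts w
  verts-mapWalk [ x ]         = refl
  verts-mapWalk (x ∷⟨ _ ⟩ w) = ≡.cong (x ∷_) (verts-mapWalk w)

  separates-⊑ : ∀ {Z X₁ X₂} → Separates G Z X₁ X₂ → Separates G' Z X₁ X₂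
  separates-⊑ {Z} {X₁} {X₂} sep x y (path w !w) x₁∈w x₂∈w =
    subst (Any (_∈ Z)) eq
      (sep x y (path (mapWalk w) (subst Unique (≡.sym eq) !w))
        (subst (Any (_∈ X₁)) (≡.sym eq) x₁∈w)
        (subst (Any (_∈ X₂)) (≡.sym eq) x₂∈w))
    where
    eq : verts (mapWalk w) ≡ verts w
    eq = verts-mapWalk w

module LoopErasure {n ℓ} {G : Graph n} {E : Rel (Fin n) ℓ}
                   (edge : ∀ {x y} → E x y → x ∼[ G ] y) where

  toWalk : ∀ {x y} → Star E x y → Walk G x y
  toWalk {x} ε       = [ x ]
  toWalk {x} (e ◅ w) = x ∷⟨ edge e ⟩ toWalk w

  suffixFrom : ∀ {x y z} (w : Star E y z) → Any (x ≡_) (verts (toWalk w)) →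
               Σ (Star E x z) λ w′ → Unique (verts (toWalk w)) → Unique (verts (toWalk w′))
  suffixFrom ε       (here refl)  = ε , id
  suffixFrom (e ◅ w) (here refl)  = e ◅ w , id
  suffixFrom (e ◅ w) (there x∈w) = map₂ (λ !suffix → λ { (_ ∷ !w) → !suffix !w }) (suffixFrom w x∈w)

  loopErase : ∀ {x y} → Star E x y → Σ (Star E x y) λ w → Unique (verts (toWalk w))
  loopErase ε = ε , [] ∷ []
  loopErase {x} (e ◅ w) with loopErase w
  ... | w′ , !w′ with any? (x ≟_) (verts (toWalk w′))
  ...   | yes x∈w′ = map₂ (_$ !w′) (suffixFrom w′ x∈w′)
  ...   | no  x∉w′ = e ◅ w′ , ¬Any⇒All¬ _ x∉w′ ∷ !w′

module _ {m} (T : Graph m) where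

  SameEdge : Fin m → Fin m → Rel (Fin m) _
  SameEdge s t c d = (c ≡ s × d ≡ t) ⊎ (c ≡ t × d ≡ s)

  AvoidingStep : Fin m → Fin m → Rel (Fin m) _
  AvoidingStep s t c d = c ∼[ T ] d × ¬ SameEdge s t c d

  AvoidingWalk : Fin m → Fin m → Rel (Fin m) _
  AvoidingWalk s t = Star (AvoidingStep s t)

module _ {m} {T : Graph m} where

  reverseAvoiding : ∀ {s t x y} → AvoidingWalk T s t x y → AvoidingWalk T s t y x
  reverseAvoiding = reverse λ { (c∼d , ¬st) → ∼-sym T c∼d , ¬st ∘ swapped }
    where
    swapped : ∀ {s t c d} → SameEdge T s t d c → SameEdge T s t c d
    swapped (inj₁ (d≡s , c≡t)) = inj₂ (c≡t , d≡s)
    swapped (inj₂ (d≡t , c≡s)) = inj₁ (c≡s , d≡t)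

  reach⇒avoiding : ∀ {A : Fin m → Set} {s t x y} →
                   ¬ (A s × A t) → Reach T A x y → AvoidingWalk T s t x y
  reach⇒avoiding ¬st (rfl _) = ε
  reach⇒avoiding ¬st (step Ax x∼y y⇝z) = (x∼y , notST) ◅ reach⇒avoiding ¬st y⇝z
    where
    notST : ¬ SameEdge T _ _ _ _
    notST (inj₁ (refl , refl)) = ¬st (Ax , reach-head y⇝z)
    notST (inj₂ (refl , refl)) = ¬st (reach-head y⇝z , Ax)

  walk⇒avoiding : ∀ {s t x y} (w : Walk T x y) → All (s ≢_) (verts w) → AvoidingWalk T s t x y
  walk⇒avoiding [ _ ] _ = ε
  walk⇒avoiding (x ∷⟨ x∼y ⟩ w) (s≢x ∷ s∉w) = (x∼y , notST) ◅ walk⇒avoiding w s∉w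
    where
    notST : ¬ SameEdge T _ _ _ _
    notST (inj₁ (refl , _)) = s≢x refl
    notST (inj₂ (_ , refl)) = walk-head w s∉w refl

  treeEdge-bridge : IsTree T → ∀ {s t} → s ∼[ T ] t → ¬ AvoidingWalk T s t s t
  treeEdge-bridge (_ , _ , uniquePath) {s} {t} s∼t w = noPath (loopErase w)
    where
    open LoopErasure {E = AvoidingStep T s t} proj₁
    !st : Unique (s ∷ t ∷ [])
    !st = (∼-irrefl T s∼t ∷ []) ∷ [] ∷ []
    shape : (p : AvoidingWalk T s t s t) → verts (toWalk p) ≡ s ∷ t ∷ [] → ⊥
    shape ε ()
    shape ((_ , ¬st) ◅ ε) _ = ¬st (inj₁ (refl , refl))
    shape (_ ◅ _ ◅ ε) ()
    shape (_ ◅ _ ◅ _ ◅ _) ()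
    noPath : Σ (AvoidingWalk T s t s t) (λ p → Unique (verts (toWalk p))) → ⊥
    noPath (p , !p) = shape p (uniquePath s t (path (toWalk p) !p) (path (s ∷⟨ s∼t ⟩ [ t ]) !st))

  record ExitEdge (U V : Fin m → Set) (b : Fin m) : Set where
    field
      {s t} : Fin m
      s∼t : s ∼[ T ] t
      Us  : U s
      ¬Ut : ¬ U t
      ¬Vs : ¬ V s
      t⇝b : AvoidingWalk T s t t b

  firstExit : ∀ {U V : Fin m → Set} → Decidable U → Decidable V →
              ∀ {a b} (w : Walk T a b) → Unique (verts w) → U a → V b →
              (∃ λ r → U r × V r) ⊎ ExitEdge U V b
  firstExit U? V? [ a ] _ Ua Vb = inj₁ (a , Ua , Vb)
  firstExit U? V? (_∷⟨_⟩_ a {y} a∼y w) (a∉w ∷ !w) Ua Vb with V? a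
  ... | yes Va = inj₁ (a , Ua , Va)
  ... | no ¬Va with U? y
  ...   | yes Uy = firstExit U? V? w !w Uy Vb
  ...   | no ¬Uy = inj₂ (record { s∼t = a∼y ; Us = Ua ; ¬Ut = ¬Uy ; ¬Vs = ¬Va
                                ; t⇝b = walk⇒avoiding w a∉w })

module _ {n m} {H : Graph n} {T : Graph m} {bag : Fin m → Subset n}
         (td : IsTreeDecomp H T bag) (s t : Fin m) where

  open IsTreeDecomp td

  OnSide : Fin n → Set
  OnSide x = ∃ λ r → x ∈ bag r × AvoidingWalk T s t s r

  bags-avoiding : ∀ {x r r'} → x ∉ adhesion bag s t → x ∈ bag r → x ∈ bag r' →
                  AvoidingWalk T s t r r'
  bags-avoiding {x} {r} {r'} x∉A x∈r x∈r' =
    reach⇒avoiding (x∉A ∘ x∈p∩q⁺) (vertConn x r r' x∈r x∈r')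

  onSide-closed : ∀ {x z} → Reach H (_∉ adhesion bag s t) x z → OnSide x → OnSide z
  onSide-closed (rfl _) = id
  onSide-closed (step {x} {y} x∉A x∼y y⇝z) (r , x∈r , s⇝r) with edgeCov x y x∼y
  ... | r' , x∈r' , y∈r' = onSide-closed y⇝z (r' , y∈r' , s⇝r ◅◅ bags-avoiding x∉A x∈r x∈r')

module _ {n m} {G G' : Graph n} {T : Graph m} {bag : Fin m → Subset n}
         (td : IsTreeDecomp G' T bag) where

  open IsTreeDecomp td

  edgeCov-transfer : (∀ s t → s ∼[ T ] t → SameComponentsMinus G G' (adhesion bag s t)) →
                     ∀ u v → u ∼[ G ] v → ∃ λ r → u ∈ bag r × v ∈ bag r
  edgeCov-transfer sameComps u v u∼v
    with vertNonEm u | vertNonEm v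
  ... | a , u∈a | b , v∈b
    with treePath ← proj₁ (proj₂ tree) a b
    with firstExit (λ r → u ∈? bag r) (λ r → v ∈? bag r) (walk treePath) (distinct treePath) u∈a v∈b
  ... | inj₁ common = common
  ... | inj₂ exit   = ⊥-elim (treeEdge-bridge tree s∼t s⇝t)
    where
    open ExitEdge exit
    u∉A : u ∉ adhesion bag s t
    u∉A = ¬Ut ∘ proj₂ ∘ x∈p∩q⁻ (bag s) (bag t)
    v∉A : v ∉ adhesion bag s t
    v∉A = ¬Vs ∘ proj₁ ∘ x∈p∩q⁻ (bag s) (bag t)
    u⇝v : Reach G' (_∉ adhesion bag s t) u v
    u⇝v = proj₁ (sameComps s t s∼t u v u∉A v∉A) (step u∉A u∼v (rfl v∉A))
    s⇝t : AvoidingWalk T s t s t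
    s⇝t with onSide-closed td s t u⇝v (s , Us , ε)
    ... | r , v∈r , s⇝r = s⇝r ◅◅ bags-avoiding td s t v∉A v∈r v∈b ◅◅ reverseAvoiding {T = T} t⇝b

lemma5p2 : ∀ {n : ℕ} (G G' : Graph n) (k : ℕ) → 1 ≤ k → IsSparsifier k G G' →
    ∀ {m : ℕ} (T : Graph m) (bag : Fin m → Subset n) →
    IsKLean k G' T bag → IsKLean k G T bag
lemma5p2 G G' k _ (G'⊑G , sparse) T bag leanG' = record
  { treeDecomp = record
    { tree      = tree
    ; edgeCov   = edgeCov-transfer treeDecomp (λ s t s∼t → sparse _ (smallAdh s t s∼t))
    ; vertNonEm = vertNonEm
    ; vertConn  = vertConn
    }
  ; smallAdh = smallAdh
  ; lean     = λ t₁ t₂ X₁ X₂ X₁⊆ X₂⊆ k' Z ∣Z∣ <X₁ <X₂ <k sep →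
                 lean t₁ t₂ X₁ X₂ X₁⊆ X₂⊆ k' Z ∣Z∣ <X₁ <X₂ <k (separates-⊑ G'⊑G sep)
  }
  where
  open IsKLean leanG'
  open IsTreeDecomp treeDecomp
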